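{- Let $k,l,d$ be nonnegative integers with $k\le 15$, $2^k-k\le l\le 2^k$ and $d\ge l+k$. Then every level-$l$ $k$-cube in $Q^d$ is $\mathbf{0}$-stackable.
   Context: $Q^d$ has vertex set $\{0,1\}^d$, adjacency meaning differing in exactly one coordinate; $\mathbf{0}$ is the all-zeros vertex. Writing $Q^d=Q^{d-k}\,\square\,Q^k$, for each $S\subseteq\{1,\dots,d-k\}$ the $k$-cube labeled $S$ is the set of vertices whose first $d-k$ coordinates are the indicator vector of $S$ (last $k$ coordinates arbitrary); its level is $|S|$. A configuration is a function $C:V\to\mathbb{N}$ (numbers of cups); a cup stacking move from $u$ to $v$ is allowed when $C(u)\ge1$, $C(v)\ge1$ and $\mathrm{dist}_{Q^d}(u,v)=C(u)$, and moves all cups of $u$ onto $v$. A set $U$ of vertices of $Q^d$ is $\mathbf{0}$-stackable if, starting from the configuration with one cup on each vertex of $U\cup\{\mathbf{0}\}$ and none elsewhere, some sequence of moves in $Q^d$ puts all cups on $\mathbf{0}$. -}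

module Defs where

open import Data.Nat using (ℕ; zero; suc; _+_; _≤_; _≥_)
open import Data.Bool using (Bool; true; false; _∨_; if_then_else_)
open import Data.Bool.Properties using () renaming (_≟_ to _≟ᵇ_)
open import Data.Vec using (Vec; []; _∷_; replicate; take)
open import Data.Vec.Properties using (≡-dec)
open import Data.Product using (Σ; ∃; _×_; _,_)
open import Relation.Nullary.Decidable using (⌊_⌋)
open import Relation.Binary.PropositionalEquality using (_≡_; _≢_)
open import Relation.Binary.Construct.Closure.ReflexiveTransitive using (Star)

Vertex : ℕ → Set
Vertex d = Vec Bool d

𝟎 : ∀ {d} → Vertex d
𝟎 = replicate _ false

dist : ∀ {d} → Vertex d → Vertex d → ℕ
dist [] [] = zero
dist (true ∷ xs) (true ∷ ys) = dist xs ys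
dist (false ∷ xs) (false ∷ ys) = dist xs ys
dist (true ∷ xs) (false ∷ ys) = suc (dist xs ys)
dist (false ∷ xs) (true ∷ ys) = suc (dist xs ys)

popcount : ∀ {n} → Vec Bool n → ℕ
popcount [] = zero
popcount (true ∷ xs) = suc (popcount xs)
popcount (false ∷ xs) = popcount xs

_≟V_ : ∀ {d} → (x y : Vertex d) → _
_≟V_ = ≡-dec _≟ᵇ_

-- Configurations: number of cups on each vertex
Config : ℕ → Set
Config d = Vertex d → ℕ

Move : ∀ {d} → Config d → Config d → Set
Move {d} C C' = Σ (Vertex d) λ u → Σ (Vertex d) λ v →
  (1 ≤ C u) × (1 ≤ C v) × (dist u v ≡ C u) ×
  (C' u ≡ 0) × (C' v ≡ C v + C u) ×
  (∀ w → w ≢ u → w ≢ v → C' w ≡ C w)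

initConfig : ∀ {d} → (Vertex d → Bool) → Config d
initConfig U x = if U x ∨ ⌊ x ≟V 𝟎 ⌋ then 1 else 0

AllOnZero : ∀ {d} → Config d → Set
AllOnZero C = ∀ w → w ≢ 𝟎 → C w ≡ 0

ZeroStackable : ∀ {d} → (Vertex d → Bool) → Set
ZeroStackable U = ∃ λ C → Star Move (initConfig U) C × AllOnZero C

-- Q^(m+k) = Q^m □ Q^k.  The k-cube labelled S ⊆ {1..m} (S given by its
-- indicator vector of length m) is the set of vertices whose first m
-- coordinates equal S; its level is |S| = popcount S.
kCube : ∀ m k → Vec Bool m → Vertex (m + k) → Bool
kCube m k S x = ⌊ take m x ≟V S ⌋

-- Call Q^k corner-stackable if every isometric copy of Q^k minus a vertex v can be stacked onto v, and
-- (k, s)-height-stackable if every copy can be stacked onto an outside vertex z whose distance to the copy of y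
-- is s + |y|.  Splitting a cube into two opposite faces shows that corner(k) and height(k, 1) give corner(k + 1),
-- and that height(k, s) and height(k, s + 1) give height(k + 1, s).  Corner(k) gives height(k, s) whenever
-- 2^k - k ≤ s ≤ 2^k: pile the copy onto its vertex of weight 2^k - s, which lies at distance exactly 2^k from z,
-- and move all 2^k cups at once.  Six explicit stacking forests, for (4, 3), (4, 4) and (5, 7), …, (5, 10), fill
-- the gaps this leaves, and the recursion then reaches corner(k) for every k ≤ 15.  A level-l k-cube is a copy
-- of Q^k at height l above 𝟎, and l lies in the window of k.
module Submission where

open import Defs
open import Level using (0ℓ)
open import Data.Nat using (ℕ; zero; suc; _+_; _∸_; _^_; _≤_; _<_; _≤ᵇ_; _≡ᵇ_; _%_; _/_; z≤n; s≤s; s≤s⁻¹)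
open import Data.Nat.Properties
  using (+-identityʳ; +-assoc; +-suc; m≤m+n; ≤-refl; ≤-trans; n≤1+n; <⇒≤; <⇒≱; +-mono-≤; m^n>0; m+[n∸m]≡n;
         +-∸-comm; ∸-monoʳ-≤; m∸[m∸n]≡n; m<n⇒0<n∸m; m≤n⇒m<n∨m≡n; ≤ᵇ⇒≤; ≡ᵇ⇒≡)
open import Data.Bool using (Bool; true; false; not; _xor_; T) renaming (_≟_ to _≟ᵇ_)
open import Data.Bool.Properties using (not-¬; ¬-not; xor-assoc; xor-same; xor-identityˡ; xor-identityʳ)
open import Data.Vec using (Vec; []; _∷_; head; tail; zipWith; take; drop) renaming (_++_ to _++ᵛ_)
open import Data.Vec.Properties using (zipWith-identityˡ; take++drop≡id; ++-injectiveˡ)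
open import Data.List using (List; []; _∷_; _++_; map)
open import Data.List.Membership.Propositional using (_∈_; _∉_)
open import Data.List.Membership.Propositional.Properties using (∈-++⁺ˡ; ∈-++⁺ʳ; ∈-++⁻; ∈-map⁺)
open import Data.List.Relation.Unary.Any using (here; there)
open import Data.List.Relation.Unary.All as All using (all?)
open import Data.List.Relation.Unary.All.Properties using (++⁻ˡ; ++⁻ʳ)
open import Data.List.Relation.Unary.Unique.Propositional using (Unique; []; _∷_)
open import Data.Product using (∃; _×_; _,_; proj₁; proj₂)
open import Data.Sum as Sum using (inj₁; inj₂)
open import Data.Unit using (⊤; tt)
open import Function using (_∘_)
open import Relation.Nullary using (¬_; yes; no; contradiction)
open import Relation.Nullary.Decidable using (True; toWitness)
open import Relation.Unary using (Pred; ∅; U; ｛_｝; ∁; _∪_; _⊆_; _≐_; _⊥_)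
open import Relation.Unary.Properties using (≐-sym; ≐-trans)
open import Relation.Binary.PropositionalEquality
open import Relation.Binary.Construct.Closure.ReflexiveTransitive using (Star; ε; _◅_; _◅◅_)

dist-refl : ∀ {d} (x : Vertex d) → dist x x ≡ 0
dist-refl [] = refl
dist-refl (true ∷ x) = dist-refl x
dist-refl (false ∷ x) = dist-refl x

dist≡0⇒≡ : ∀ {d} {x y : Vertex d} → dist x y ≡ 0 → x ≡ y
dist≡0⇒≡ {x = []} {[]} _ = refl
dist≡0⇒≡ {x = true ∷ x} {true ∷ y} eq = cong (true ∷_) (dist≡0⇒≡ eq)
dist≡0⇒≡ {x = false ∷ x} {false ∷ y} eq = cong (false ∷_) (dist≡0⇒≡ eq)

dist-∷-same : ∀ {d} b (x y : Vertex d) → dist (b ∷ x) (b ∷ y) ≡ dist x y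
dist-∷-same true x y = refl
dist-∷-same false x y = refl

dist-∷-notˡ : ∀ {d} b (x y : Vertex d) → dist (not b ∷ x) (b ∷ y) ≡ suc (dist x y)
dist-∷-notˡ true x y = refl
dist-∷-notˡ false x y = refl

dist-∷-notʳ : ∀ {d} b (x y : Vertex d) → dist (b ∷ x) (not b ∷ y) ≡ suc (dist x y)
dist-∷-notʳ true x y = refl
dist-∷-notʳ false x y = refl

VertexSet : ℕ → Set₁
VertexSet d = Pred (Vertex d) 0ℓ

record Gathered {d} (P : VertexSet d) (z : Vertex d) (n : ℕ) (C : Config d) : Set where
  field
    final     : Config d
    moves     : Star Move C final
    emptied   : ∀ x → P x → final x ≡ 0
    collected : final z ≡ C z + n
    untouched : ∀ x → ¬ P x → x ≢ z → final x ≡ C x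

Gathers : ∀ {d} → VertexSet d → Vertex d → ℕ → Set
Gathers P z n = ∀ C → (∀ x → P x → C x ≡ 1) → 1 ≤ C z → Gathered P z n C

gathers-∅ : ∀ {d} {z : Vertex d} → Gathers ∅ z 0
gathers-∅ C _ _ = record
  { final = C ; moves = ε ; emptied = λ _ () ; collected = sym (+-identityʳ _) ; untouched = λ _ _ _ → refl }

gathers-cong : ∀ {d} {P Q : VertexSet d} {z n} → P ≐ Q → Gathers P z n → Gathers Q z n
gathers-cong (P⊆Q , Q⊆P) gather C one z≥1 = record
  { final = final ; moves = moves ; emptied = λ x → emptied x ∘ Q⊆P
  ; collected = collected ; untouched = λ x x∉Q → untouched x (x∉Q ∘ P⊆Q) }
  where open Gathered (gather C (λ x → one x ∘ P⊆Q) z≥1)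

gathers-∪ : ∀ {d} {P Q : VertexSet d} {z a b} → Gathers P z a → Gathers Q z b →
  P ⊥ Q → ¬ P z → ¬ Q z → Gathers (P ∪ Q) z (a + b)
gathers-∪ {Q = Q} {z = z} {a = a} {b = b} gatherP gatherQ P⊥Q z∉P z∉Q C one z≥1 = record
  { final = G₂.final
  ; moves = G₁.moves ◅◅ G₂.moves
  ; emptied = λ { x (inj₁ p) → trans (G₂.untouched x (λ q → P⊥Q (p , q)) λ { refl → z∉P p }) (G₁.emptied x p)
                ; x (inj₂ q) → G₂.emptied x q }
  ; collected = trans G₂.collected (trans (cong (_+ b) G₁.collected) (+-assoc (C z) a b))
  ; untouched = λ x x∉P∪Q x≢z →
      trans (G₂.untouched x (x∉P∪Q ∘ inj₂) x≢z) (G₁.untouched x (x∉P∪Q ∘ inj₁) x≢z)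
  }
  where
  module G₁ = Gathered (gatherP C (λ x → one x ∘ inj₁) z≥1)
  Q-untouched : ∀ x → Q x → G₁.final x ≡ 1
  Q-untouched x q = trans (G₁.untouched x (λ p → P⊥Q (p , q)) λ { refl → z∉Q q }) (one x (inj₂ q))
  z-nonempty : 1 ≤ G₁.final z
  z-nonempty = subst (1 ≤_) (sym G₁.collected) (≤-trans z≥1 (m≤m+n _ a))
  module G₂ = Gathered (gatherQ G₁.final Q-untouched z-nonempty)

moveAll : ∀ {d} → Config d → Vertex d → Vertex d → Config d
moveAll C u v w with w ≟V u | w ≟V v
... | yes _ | _     = 0
... | no _  | yes _ = C v + C u
... | no _  | no _  = C w

moveAll-source : ∀ {d} (C : Config d) u v → moveAll C u v u ≡ 0
moveAll-source C u v with u ≟V u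
... | yes _ = refl
... | no u≢u = contradiction refl u≢u

moveAll-target : ∀ {d} (C : Config d) {u v} → u ≢ v → moveAll C u v v ≡ C v + C u
moveAll-target C {u} {v} u≢v with v ≟V u | v ≟V v
... | yes v≡u | _      = contradiction (sym v≡u) u≢v
... | no _    | yes _  = refl
... | no _    | no v≢v = contradiction refl v≢v

moveAll-elsewhere : ∀ {d} (C : Config d) {u v} w → w ≢ u → w ≢ v → moveAll C u v w ≡ C w
moveAll-elsewhere C {u} {v} w w≢u w≢v with w ≟V u | w ≟V v
... | yes w≡u | _       = contradiction w≡u w≢u
... | no _    | yes w≡v = contradiction w≡v w≢v
... | no _    | no _    = refl

moveAll-isMove : ∀ {d} (C : Config d) {u v} → 1 ≤ C u → 1 ≤ C v → dist u v ≡ C u → u ≢ v →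
  Move C (moveAll C u v)
moveAll-isMove C {u} {v} u≥1 v≥1 dist≡ u≢v =
  u , v , u≥1 , v≥1 , dist≡ , moveAll-source C u v , moveAll-target C u≢v , moveAll-elsewhere C

gathers-then-move : ∀ {d} {B : VertexSet d} {t z n} → Gathers B t n → ¬ B t → ¬ B z → t ≢ z →
  dist t z ≡ suc n → Gathers (B ∪ ｛ t ｝) z (suc n)
gathers-then-move {t = t} {z = z} {n = n} gather t∉B z∉B t≢z dist≡ C one z≥1 = record
  { final = moveAll G.final t z
  ; moves = G.moves ◅◅ (move ◅ ε)
  ; emptied = λ { x (inj₁ b) → trans (elsewhere x (λ { refl → t∉B b }) (λ { refl → z∉B b })) (G.emptied x b)
                ; x (inj₂ refl) → moveAll-source G.final t z }
  ; collected = trans (moveAll-target G.final t≢z) (cong₂ _+_ z-kept t-pile)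
  ; untouched = λ x x∉ x≢z →
      trans (elsewhere x (x∉ ∘ inj₂ ∘ sym) x≢z) (G.untouched x (x∉ ∘ inj₁) (x∉ ∘ inj₂ ∘ sym))
  }
  where
  module G = Gathered (gather C (λ x → one x ∘ inj₁) (subst (1 ≤_) (sym (one t (inj₂ refl))) (s≤s z≤n)))
  elsewhere = moveAll-elsewhere G.final
  t-pile : G.final t ≡ suc n
  t-pile = trans G.collected (cong (_+ n) (one t (inj₂ refl)))
  z-kept : G.final z ≡ C z
  z-kept = G.untouched z z∉B (t≢z ∘ sym)
  move : Move G.final (moveAll G.final t z)
  move = moveAll-isMove G.final (subst (1 ≤_) (sym t-pile) (s≤s z≤n)) (subst (1 ≤_) (sym z-kept) z≥1)
    (trans dist≡ (sym t-pile)) t≢z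

Isometric : ∀ {m d} → (Vertex m → Vertex d) → Set
Isometric e = ∀ y y' → dist (e y) (e y') ≡ dist y y'

isometric⇒injective : ∀ {m d} (e : Vertex m → Vertex d) → Isometric e → ∀ {y y'} → e y ≡ e y' → y ≡ y'
isometric⇒injective e iso {y} {y'} ey≡ey' =
  dist≡0⇒≡ (trans (sym (iso y y')) (trans (cong (dist (e y)) (sym ey≡ey')) (dist-refl (e y))))

Image : ∀ {m d} → (Vertex m → Vertex d) → VertexSet m → VertexSet d
Image e B x = ∃ λ y → B y × e y ≡ x

height⇒∉Image : ∀ {m d} (e : Vertex m → Vertex d) {B z s} {h : Vertex m → ℕ} → 1 ≤ s →
  (∀ y → dist (e y) z ≡ s + h y) → ¬ Image e B z
height⇒∉Image e {s = suc s} _ height (y , _ , refl) with trans (sym (dist-refl (e y))) (height y)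
... | ()

Image-cong : ∀ {m d} {e : Vertex m → Vertex d} {B B'} → B ≐ B' → Image e B ≐ Image e B'
Image-cong (B⊆B' , B'⊆B) = (λ (y , b , eq) → y , B⊆B' b , eq) , (λ (y , b , eq) → y , B'⊆B b , eq)

face : ∀ {m a} {A : Set a} → Bool → (Vertex (suc m) → A) → Vertex m → A
face b f y = f (b ∷ y)

face-isometric : ∀ {m d} (e : Vertex (suc m) → Vertex d) b → Isometric e → Isometric (face b e)
face-isometric e b iso y y' = trans (iso (b ∷ y) (b ∷ y')) (dist-∷-same b y y')

faces-disjoint : ∀ {m d} (e : Vertex (suc m) → Vertex d) {P Q} b → Isometric e →
  Image (face b e) P ⊥ Image (face (not b) e) Q
faces-disjoint e b iso ((y , _ , refl) , (y' , _ , ey'≡ey)) =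
  not-¬ refl (sym (cong head (isometric⇒injective e iso ey'≡ey)))

Image-faces : ∀ {m d} {e : Vertex (suc m) → Vertex d} {B} b →
  Image e B ≐ Image (face b e) (face b B) ∪ Image (face (not b) e) (face (not b) B)
Image-faces b = split , join
  where
  split : Image _ _ ⊆ _
  split (c ∷ y , by , refl) with c ≟ᵇ b
  ... | yes refl = inj₁ (y , by , refl)
  ... | no c≢b with refl ← ¬-not c≢b = inj₂ (y , by , refl)
  join : _ ⊆ Image _ _
  join (inj₁ (y , by , refl)) = b ∷ y , by , refl
  join (inj₂ (y , by , refl)) = not b ∷ y , by , refl

∪-cong : ∀ {d} {P P' Q Q' : VertexSet d} → P ≐ P' → Q ≐ Q' → P ∪ Q ≐ P' ∪ Q'
∪-cong (P⊆P' , P'⊆P) (Q⊆Q' , Q'⊆Q) = Sum.map P⊆P' Q⊆Q' , Sum.map P'⊆P Q'⊆Q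

_⊕_ : ∀ {m} → Vertex m → Vertex m → Vertex m
_⊕_ = zipWith _xor_

⊕-isometric : ∀ {m} (x y w : Vertex m) → dist (x ⊕ w) (y ⊕ w) ≡ dist x y
⊕-isometric [] [] [] = refl
⊕-isometric (true ∷ x) (true ∷ y) (b ∷ w) = trans (dist-∷-same (not b) _ _) (⊕-isometric x y w)
⊕-isometric (false ∷ x) (false ∷ y) (b ∷ w) = trans (dist-∷-same b _ _) (⊕-isometric x y w)
⊕-isometric (true ∷ x) (false ∷ y) (b ∷ w) = trans (dist-∷-notˡ b _ _) (cong suc (⊕-isometric x y w))
⊕-isometric (false ∷ x) (true ∷ y) (b ∷ w) = trans (dist-∷-notʳ b _ _) (cong suc (⊕-isometric x y w))

⊕-involutive : ∀ {m} (y w : Vertex m) → (y ⊕ w) ⊕ w ≡ y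
⊕-involutive [] [] = refl
⊕-involutive (a ∷ y) (b ∷ w) =
  cong₂ _∷_ (trans (xor-assoc a b b) (trans (cong (a xor_) (xor-same b)) (xor-identityʳ a))) (⊕-involutive y w)

2^k+2^k≡2^[1+k] : ∀ k → 2 ^ k + 2 ^ k ≡ 2 ^ suc k
2^k+2^k≡2^[1+k] k = cong (2 ^ k +_) (sym (+-identityʳ (2 ^ k)))

1+[2^k∸1]≡2^k : ∀ k → suc (2 ^ k ∸ 1) ≡ 2 ^ k
1+[2^k∸1]≡2^k k = m+[n∸m]≡n (m^n>0 2 k)

[2^k∸1]+2^k≡2^[1+k]∸1 : ∀ k → (2 ^ k ∸ 1) + 2 ^ k ≡ 2 ^ suc k ∸ 1
[2^k∸1]+2^k≡2^[1+k]∸1 k =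
  trans (cong (2 ^ k ∸ 1 +_) (sym (+-identityʳ (2 ^ k)))) (sym (+-∸-comm (2 ^ k + 0) (m^n>0 2 k)))

n<2^n : ∀ n → n < 2 ^ n
n<2^n zero = s≤s z≤n
n<2^n (suc n) = subst (suc n <_) (2^k+2^k≡2^[1+k] n) (+-mono-≤ (m^n>0 2 n) (n<2^n n))

CornerStackable : ℕ → Set
CornerStackable k = ∀ {d} (e : Vertex k → Vertex d) → Isometric e → ∀ v →
  Gathers (Image e (∁ ｛ v ｝)) (e v) (2 ^ k ∸ 1)

HeightStackable : ℕ → ℕ → Set
HeightStackable k s = ∀ {d} (e : Vertex k → Vertex d) → Isometric e → ∀ z →
  (∀ y → dist (e y) z ≡ s + dist y 𝟎) → Gathers (Image e U) z (2 ^ k)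

heightStackable-translate : ∀ {k s} → HeightStackable k s → ∀ {d} (e : Vertex k → Vertex d) → Isometric e →
  ∀ z w → (∀ y → dist (e y) z ≡ s + dist y w) → Gathers (Image e U) z (2 ^ k)
heightStackable-translate {s = s} stack e iso z w height =
  gathers-cong (shift , unshift) (stack (e ∘ (_⊕ w)) shifted-iso z shifted-height)
  where
  shifted-iso : Isometric (e ∘ (_⊕ w))
  shifted-iso y y' = trans (iso (y ⊕ w) (y' ⊕ w)) (⊕-isometric y y' w)
  shifted-height : ∀ y → dist (e (y ⊕ w)) z ≡ s + dist y 𝟎
  shifted-height y = begin
    dist (e (y ⊕ w)) z       ≡⟨ height (y ⊕ w) ⟩
    s + dist (y ⊕ w) w       ≡⟨ cong (λ w' → s + dist (y ⊕ w) w') (zipWith-identityˡ xor-identityˡ w) ⟨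
    s + dist (y ⊕ w) (𝟎 ⊕ w) ≡⟨ cong (s +_) (⊕-isometric y 𝟎 w) ⟩
    s + dist y 𝟎             ∎
    where open ≡-Reasoning
  shift : Image (e ∘ (_⊕ w)) U ⊆ Image e U
  shift (y , _ , eq) = y ⊕ w , tt , eq
  unshift : Image e U ⊆ Image (e ∘ (_⊕ w)) U
  unshift (y , _ , eq) = y ⊕ w , tt , trans (cong e (⊕-involutive y w)) eq

cornerStackable-zero : CornerStackable 0
cornerStackable-zero e iso [] = gathers-cong ((λ ()) , λ { ([] , []≢[] , _) → []≢[] refl }) gathers-∅

cornerStackable-suc : ∀ {k} → CornerStackable k → HeightStackable k 1 → CornerStackable (suc k)
cornerStackable-suc {k} corner height e iso (b ∷ v) =
  subst (Gathers _ (e (b ∷ v))) ([2^k∸1]+2^k≡2^[1+k]∸1 k)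
    (gathers-cong (≐-sym split)
      (gathers-∪ (corner (face b e) (face-isometric e b iso) v) other-face (faces-disjoint e b iso)
                 (λ (y , v≢y , eq) → v≢y (sym (cong tail (isometric⇒injective e iso eq))))
                 (height⇒∉Image (face (not b) e) {s = 1} (s≤s z≤n) one-above)))
  where
  one-above : ∀ y → dist (e (not b ∷ y)) (e (b ∷ v)) ≡ 1 + dist y v
  one-above y = trans (iso (not b ∷ y) (b ∷ v)) (dist-∷-notˡ b y v)
  other-face : Gathers (Image (face (not b) e) U) (e (b ∷ v)) (2 ^ k)
  other-face = heightStackable-translate height (face (not b) e) (face-isometric e (not b) iso) (e (b ∷ v)) v one-above
  split : Image e (∁ ｛ b ∷ v ｝) ≐ Image (face b e) (∁ ｛ v ｝) ∪ Image (face (not b) e) U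
  split = ≐-trans (Image-faces b) (∪-cong (Image-cong on-face) (Image-cong off-face))
    where
    on-face : face b (∁ ｛ b ∷ v ｝) ≐ ∁ ｛ v ｝
    on-face = (λ ne eq → ne (cong (b ∷_) eq)) , (λ ne eq → ne (cong tail eq))
    off-face : face (not b) (∁ ｛ b ∷ v ｝) ≐ U
    off-face = (λ _ → tt) , (λ _ eq → not-¬ refl (cong head eq))

heightStackable-suc : ∀ {k s} → 1 ≤ s → HeightStackable k s → HeightStackable k (suc s) → HeightStackable (suc k) s
heightStackable-suc {k} {s} s≥1 low high e iso z height =
  subst (Gathers _ z) (2^k+2^k≡2^[1+k] k)
    (gathers-cong (≐-sym (Image-faces false))
      (gathers-∪ (low (face false e) (face-isometric e false iso) z (height ∘ (false ∷_)))
                 (high (face true e) (face-isometric e true iso) z height-true)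
                 (faces-disjoint e false iso)
                 (height⇒∉Image (face false e) s≥1 (height ∘ (false ∷_)))
                 (height⇒∉Image (face true e) {s = suc s} (s≤s z≤n) height-true)))
  where
  height-true : ∀ y → dist (e (true ∷ y)) z ≡ suc s + dist y 𝟎
  height-true y = trans (height (true ∷ y)) (+-suc s (dist y 𝟎))

vertex-of-weight : ∀ {m} n → n ≤ m → ∃ λ (v : Vertex m) → dist v 𝟎 ≡ n
vertex-of-weight {m} zero _ = 𝟎 , dist-refl (𝟎 {m})
vertex-of-weight (suc n) (s≤s n≤m) with vertex-of-weight n n≤m
... | v , weight = true ∷ v , cong suc weight

heightStackable-window : ∀ {k} → CornerStackable k → ∀ s → 2 ^ k ∸ k ≤ s → s ≤ 2 ^ k → HeightStackable k s
heightStackable-window {k} corner s lo hi e iso z height =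
  subst (Gathers _ z) (1+[2^k∸1]≡2^k k)
    (gathers-cong (≐-sym split)
      (gathers-then-move (corner e iso v) ev∉ z∉ (λ ev≡z → z∉ (v , tt , ev≡z)) ev-far))
  where
  z∉ : ∀ {B} → ¬ Image e B z
  z∉ = height⇒∉Image e (≤-trans (m<n⇒0<n∸m (n<2^n k)) lo) height
  weight≤k : 2 ^ k ∸ s ≤ k
  weight≤k = subst (2 ^ k ∸ s ≤_) (m∸[m∸n]≡n (<⇒≤ (n<2^n k))) (∸-monoʳ-≤ (2 ^ k) lo)
  v = proj₁ (vertex-of-weight (2 ^ k ∸ s) weight≤k)
  ev∉ : ¬ Image e (∁ ｛ v ｝) (e v)
  ev∉ (y , v≢y , ey≡ev) = v≢y (sym (isometric⇒injective e iso ey≡ev))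
  ev-far : dist (e v) z ≡ suc (2 ^ k ∸ 1)
  ev-far = begin
    dist (e v) z     ≡⟨ height v ⟩
    s + dist v 𝟎     ≡⟨ cong (s +_) (proj₂ (vertex-of-weight (2 ^ k ∸ s) weight≤k)) ⟩
    s + (2 ^ k ∸ s)  ≡⟨ m+[n∸m]≡n hi ⟩
    2 ^ k            ≡⟨ sym (1+[2^k∸1]≡2^k k) ⟩
    suc (2 ^ k ∸ 1)  ∎
    where open ≡-Reasoning
  split : Image e U ≐ Image e (∁ ｛ v ｝) ∪ ｛ e v ｝
  split = to , from
    where
    to : Image e U ⊆ Image e (∁ ｛ v ｝) ∪ ｛ e v ｝
    to (y , _ , refl) with v ≟V y
    ... | yes refl = inj₂ refl
    ... | no v≢y = inj₁ (y , v≢y , refl)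
    from : Image e (∁ ｛ v ｝) ∪ ｛ e v ｝ ⊆ Image e U
    from (inj₁ (y , _ , eq)) = y , tt , eq
    from (inj₂ refl) = v , tt , refl

Unique-++⁻ : ∀ {A : Set} (xs : List A) {ys} → Unique (xs ++ ys) →
  Unique xs × Unique ys × (∀ {x} → x ∈ xs → x ∉ ys)
Unique-++⁻ [] unique = [] , unique , λ ()
Unique-++⁻ (x ∷ xs) (x∉ ∷ unique) with Unique-++⁻ xs unique
... | unique-xs , unique-ys , disjoint =
  ++⁻ˡ xs x∉ ∷ unique-xs , unique-ys ,
  λ { (here refl) y∈ys → All.lookup (++⁻ʳ xs x∉) y∈ys refl ; (there x∈xs) → disjoint x∈xs }

allVertices : ∀ m → List (Vertex m)
allVertices zero = [] ∷ []
allVertices (suc m) = map (false ∷_) (allVertices m) ++ map (true ∷_) (allVertices m)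

∈-allVertices : ∀ {m} (y : Vertex m) → y ∈ allVertices m
∈-allVertices [] = here refl
∈-allVertices {suc m} (false ∷ y) = ∈-++⁺ˡ (∈-map⁺ (false ∷_) (∈-allVertices y))
∈-allVertices {suc m} (true ∷ y) = ∈-++⁺ʳ (map (false ∷_) (allVertices m)) (∈-map⁺ (true ∷_) (∈-allVertices y))

Image-∷ : ∀ {m d} {e : Vertex m → Vertex d} {v xs} → Image e (_∈ v ∷ xs) ≐ Image e (_∈ xs) ∪ ｛ e v ｝
Image-∷ = (λ { (y , here refl , refl) → inj₂ refl ; (y , there y∈xs , eq) → inj₁ (y , y∈xs , eq) })
        , (λ { (inj₁ (y , y∈xs , eq)) → y , there y∈xs , eq ; (inj₂ refl) → _ , here refl , refl })

Image-++ : ∀ {m d} {e : Vertex m → Vertex d} xs {ys} →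
  Image e (_∈ xs ++ ys) ≐ Image e (_∈ xs) ∪ Image e (_∈ ys)
Image-++ xs = (λ { (y , y∈ , eq) → Sum.map (λ p → y , p , eq) (λ p → y , p , eq) (∈-++⁻ xs y∈) })
            , (λ { (inj₁ (y , p , eq)) → y , ∈-++⁺ˡ p , eq ; (inj₂ (y , p , eq)) → y , ∈-++⁺ʳ xs p , eq })

-- Tree labels are vertices of Q^m written as binary numbers, least significant bit first.
data Tree : Set where
  node : ℕ → List Tree → Tree

binary : ∀ m → ℕ → Vertex m
binary zero n = []
binary (suc m) n = (n % 2 ≡ᵇ 1) ∷ binary m (n / 2)
size : List Tree → ℕ
size [] = 0
size (node _ ts ∷ fs) = suc (size ts) + size fs

module Certificate (m : ℕ) where
  open import Data.List.Membership.DecPropositional (_≟V_ {m}) using (_∈?_)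
  open import Data.List.Relation.Unary.Unique.DecPropositional (_≟V_ {m}) using (unique?)

  vertices : List Tree → List (Vertex m)
  vertices [] = []
  vertices (node u ts ∷ fs) = binary m u ∷ vertices ts ++ vertices fs

  -- Each tree is stacked onto its root, whose pile then moves the distance δ root to the common target.
  Valid : (Vertex m → ℕ) → List Tree → Set
  Valid δ [] = ⊤
  Valid δ (node u ts ∷ fs) =
    T (δ (binary m u) ≡ᵇ suc (size ts)) × Valid (λ y → dist y (binary m u)) ts × Valid δ fs

  module _ {d} {e : Vertex m → Vertex d} (iso : Isometric e) where

    forest-gathers : ∀ δ fs {z} → Valid δ fs → Unique (vertices fs) → (∀ y → dist (e y) z ≡ δ y) →
      ¬ Image e (_∈ vertices fs) z → Gathers (Image e (_∈ vertices fs)) z (size fs)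
    forest-gathers δ [] _ _ _ _ = gathers-cong ((λ ()) , λ { (_ , () , _) }) gathers-∅
    forest-gathers δ (node u ts ∷ fs) {z} (root-ok , ts-ok , fs-ok) unique height z∉
      with Unique-++⁻ (binary m u ∷ vertices ts) unique
    ... | v∉ts ∷ unique-ts , unique-fs , disjoint =
      gathers-cong (≐-sym (Image-++ (v ∷ vertices ts)))
        (gathers-∪ tree (forest-gathers δ fs fs-ok unique-fs height (z∉ ∘ in-rest)) images-disjoint
          (z∉ ∘ in-tree) (z∉ ∘ in-rest))
      where
      v = binary m u
      in-tree : Image e (_∈ v ∷ vertices ts) ⊆ Image e (_∈ vertices (node u ts ∷ fs))
      in-tree = proj₂ (Image-++ (v ∷ vertices ts)) ∘ inj₁
      in-rest : Image e (_∈ vertices fs) ⊆ Image e (_∈ vertices (node u ts ∷ fs))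
      in-rest = proj₂ (Image-++ (v ∷ vertices ts)) ∘ inj₂
      injective = isometric⇒injective e iso
      ev∉ts : ¬ Image e (_∈ vertices ts) (e v)
      ev∉ts (y , y∈ts , ey≡ev) = All.lookup v∉ts (subst (_∈ vertices ts) (injective ey≡ev) y∈ts) refl
      tree : Gathers (Image e (_∈ v ∷ vertices ts)) z (suc (size ts))
      tree = gathers-cong (≐-sym Image-∷)
        (gathers-then-move (forest-gathers (λ y → dist y v) ts ts-ok unique-ts (λ y → iso y v) ev∉ts) ev∉ts
          (λ (y , y∈ts , eq) → z∉ (in-tree (y , there y∈ts , eq))) (λ ev≡z → z∉ (in-tree (v , here refl , ev≡z)))
          (trans (height v) (≡ᵇ⇒≡ _ _ root-ok)))
      images-disjoint : Image e (_∈ v ∷ vertices ts) ⊥ Image e (_∈ vertices fs)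
      images-disjoint ((y , y∈tree , refl) , (y' , y'∈fs , ey'≡ey)) =
        disjoint y∈tree (subst (_∈ vertices fs) (injective ey'≡ey) y'∈fs)

  certified : ∀ {s} (fs : List Tree) → 1 ≤ s → {Valid (λ y → s + dist y 𝟎) fs} →
    {True (unique? (vertices fs))} → {True (all? (_∈? vertices fs) (allVertices m))} →
    size fs ≡ 2 ^ m → HeightStackable m s
  certified fs s≥1 {ok} {unique} {covers} size≡ e iso z height =
    subst (Gathers _ z) size≡
      (gathers-cong ((λ (y , _ , eq) → y , tt , eq) , cover)
        (forest-gathers iso _ fs ok (toWitness unique) height (height⇒∉Image e s≥1 height)))
    where
    cover : Image e U ⊆ Image e (_∈ vertices fs)
    cover (y , _ , eq) = y , All.lookup (toWitness covers) (∈-allVertices y) , eq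

open Certificate using (certified)

record InRange (P : ℕ → Set) (a b : ℕ) : Set where
  constructor inRange
  field at : ∀ s → a ≤ s → s ≤ b → P s
open InRange

range-empty : ∀ {P a} → InRange P (suc a) a
range-empty = inRange λ s a<s s≤a → contradiction s≤a (<⇒≱ a<s)

infixl 5 _▸_
_▸_ : ∀ {P a b} → InRange P a b → P (suc b) → InRange P a (suc b)
_▸_ {P} {a} {b} range p = inRange extended
  where
  extended : ∀ s → a ≤ s → s ≤ suc b → P s
  extended s a≤s s≤1+b with m≤n⇒m<n∨m≡n s≤1+b
  ... | inj₁ s<1+b = at range s a≤s (s≤s⁻¹ s<1+b)
  ... | inj₂ refl = p

heightStackable-lift : ∀ {k r} → InRange (HeightStackable k) 1 (suc r) → InRange (HeightStackable (suc k)) 1 r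
heightStackable-lift heights = inRange λ s 1≤s s≤r →
  heightStackable-suc 1≤s (at heights s 1≤s (≤-trans s≤r (n≤1+n _))) (at heights (suc s) (s≤s z≤n) (s≤s s≤r))

cornerStackable-lift : ∀ {k r} → InRange CornerStackable 0 k → InRange (HeightStackable k) 1 r →
  InRange CornerStackable 0 (r + k)
cornerStackable-lift {k} {zero} corners _ = corners
cornerStackable-lift {k} {suc r} corners heights =
  subst (InRange CornerStackable 0) (+-suc r k)
    (cornerStackable-lift (corners ▸ cornerStackable-suc (at corners k z≤n ≤-refl) (at heights 1 ≤-refl (s≤s z≤n)))
                          (heightStackable-lift heights))

heightStackable-window-≤ᵇ : ∀ {k} → CornerStackable k → ∀ s → {T (2 ^ k ∸ k ≤ᵇ s)} → {T (s ≤ᵇ 2 ^ k)} →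
  HeightStackable k s
heightStackable-window-≤ᵇ {k} corner s {lo} {hi} =
  heightStackable-window corner s (≤ᵇ⇒≤ (2 ^ k ∸ k) s lo) (≤ᵇ⇒≤ s (2 ^ k) hi)

corners≤1 : InRange CornerStackable 0 1
corners≤1 = cornerStackable-lift (inRange λ { _ _ z≤n → cornerStackable-zero })
  (range-empty ▸ heightStackable-window-≤ᵇ cornerStackable-zero 1)

heights₁ : InRange (HeightStackable 1) 1 2
heights₁ = range-empty ▸ window 1 ▸ window 2
  where window = heightStackable-window-≤ᵇ (at corners≤1 1 z≤n ≤-refl)

corners≤3 : InRange CornerStackable 0 3
corners≤3 = cornerStackable-lift corners≤1 heights₁

heights₂ : InRange (HeightStackable 2) 1 4
heights₂ = heightStackable-lift heights₁ ▸ window 2 ▸ window 3 ▸ window 4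
  where window = heightStackable-window-≤ᵇ (at corners≤3 2 z≤n (n≤1+n 2))

heights₃ : InRange (HeightStackable 3) 1 3
heights₃ = heightStackable-lift heights₂

corners≤6 : InRange CornerStackable 0 6
corners≤6 = cornerStackable-lift corners≤3 heights₃

heightStackable-4-3 : HeightStackable 4 3
heightStackable-4-3 = certified 4
  ( node 6 (node 5 (node 7 [] ∷ []) ∷ node 4 [] ∷ node 14 [] ∷ [])
  ∷ node 2 (node 12 (node 10 (node 8 [] ∷ []) ∷ []) ∷ [])
  ∷ node 15 (node 3 (node 11 [] ∷ []) ∷ node 0 (node 1 [] ∷ node 9 (node 13 [] ∷ []) ∷ []) ∷ [])
  ∷ [])
  (s≤s z≤n) refl

heightStackable-4-4 : HeightStackable 4 4
heightStackable-4-4 = certified 4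
  ( node 0 (node 1 [] ∷ node 3 (node 11 [] ∷ []) ∷ [])
  ∷ node 12 (node 10 (node 8 [] ∷ []) ∷ node 15 (node 14 [] ∷ []) ∷ node 4 [] ∷ [])
  ∷ node 5 (node 7 [] ∷ node 6 (node 2 [] ∷ []) ∷ node 9 (node 13 [] ∷ []) ∷ [])
  ∷ [])
  (s≤s z≤n) refl

heights₄ : InRange (HeightStackable 4) 1 7
heights₄ = heightStackable-lift heights₃ ▸ heightStackable-4-3 ▸ heightStackable-4-4
  ▸ heightStackable-suc (s≤s z≤n) (window 5) (window 6)
  ▸ heightStackable-suc (s≤s z≤n) (window 6) (window 7)
  ▸ heightStackable-suc (s≤s z≤n) (window 7) (window 8)
  where window = heightStackable-window-≤ᵇ (at corners≤3 3 z≤n ≤-refl)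

heightStackable-5-7 : HeightStackable 5 7
heightStackable-5-7 = certified 5
  ( node 14 ( node 7 (node 15 [] ∷ [])
            ∷ node 18 (node 20 (node 21 [] ∷ []) ∷ [])
            ∷ node 12 []
            ∷ node 24 (node 10 (node 2 [] ∷ []) ∷ [])
            ∷ [])
  ∷ node 23 ( node 30 (node 26 [] ∷ [])
            ∷ node 31 []
            ∷ node 3 (node 1 [] ∷ [])
            ∷ node 8 (node 22 (node 27 (node 9 (node 11 [] ∷ []) ∷ []) ∷ []) ∷ [])
            ∷ [])
  ∷ node 29 ( node 28 []
            ∷ node 25 []
            ∷ node 4 (node 0 [] ∷ node 5 [] ∷ [])
            ∷ node 13 []
            ∷ node 6 (node 16 (node 19 (node 17 [] ∷ []) ∷ []) ∷ [])
            ∷ [])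
  ∷ [])
  (s≤s z≤n) refl

heightStackable-5-8 : HeightStackable 5 8
heightStackable-5-8 = certified 5
  ( node 27 ( node 28 (node 16 (node 17 [] ∷ []) ∷ [])
            ∷ node 20 (node 8 (node 2 (node 10 [] ∷ []) ∷ []) ∷ [])
            ∷ node 12 (node 26 (node 30 [] ∷ node 18 [] ∷ []) ∷ [])
            ∷ [])
  ∷ node 0 (node 5 (node 21 [] ∷ []) ∷ node 3 (node 19 [] ∷ []) ∷ node 7 (node 1 (node 9 [] ∷ []) ∷ []) ∷ [])
  ∷ node 23 ( node 25 (node 31 (node 29 [] ∷ []) ∷ [])
            ∷ node 13 (node 4 (node 6 [] ∷ []) ∷ [])
            ∷ node 22 []
            ∷ node 24 (node 11 (node 14 (node 15 [] ∷ []) ∷ []) ∷ [])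
            ∷ [])
  ∷ [])
  (s≤s z≤n) refl

heightStackable-5-9 : HeightStackable 5 9
heightStackable-5-9 = certified 5
  ( node 4 ( node 16 (node 20 [] ∷ [])
           ∷ node 26 (node 31 (node 23 [] ∷ []) ∷ node 27 [] ∷ [])
           ∷ node 10 (node 0 (node 8 [] ∷ []) ∷ [])
           ∷ [])
  ∷ node 9 ( node 1 []
           ∷ node 29 (node 28 [] ∷ [])
           ∷ node 11 []
           ∷ node 19 (node 25 (node 24 [] ∷ []) ∷ [])
           ∷ node 2 (node 6 [] ∷ node 3 [] ∷ [])
           ∷ [])
  ∷ node 18 ( node 22 []
            ∷ node 30 (node 14 [] ∷ [])
            ∷ node 17 (node 21 [] ∷ [])
            ∷ node 13 (node 7 (node 15 [] ∷ []) ∷ node 12 [] ∷ node 5 [] ∷ [])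
            ∷ [])
  ∷ [])
  (s≤s z≤n) refl

heightStackable-5-10 : HeightStackable 5 10
heightStackable-5-10 = certified 5
  ( node 2 ( node 21 (node 24 (node 29 (node 25 [] ∷ []) ∷ []) ∷ [])
           ∷ node 8 (node 12 [] ∷ [])
           ∷ node 28 (node 15 (node 5 (node 7 [] ∷ []) ∷ []) ∷ [])
           ∷ [])
  ∷ node 1 ( node 3 []
           ∷ node 22 (node 6 [] ∷ node 20 [] ∷ node 23 [] ∷ [])
           ∷ node 30 (node 9 (node 13 [] ∷ node 27 (node 11 [] ∷ []) ∷ []) ∷ [])
           ∷ [])
  ∷ node 0 ( node 31 (node 16 (node 17 [] ∷ node 19 (node 18 [] ∷ []) ∷ []) ∷ [])
           ∷ node 4 []
           ∷ node 14 (node 26 (node 10 [] ∷ []) ∷ [])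
           ∷ [])
  ∷ [])
  (s≤s z≤n) refl

heights₅ : InRange (HeightStackable 5) 1 10
heights₅ = heightStackable-lift heights₄
  ▸ heightStackable-5-7 ▸ heightStackable-5-8 ▸ heightStackable-5-9 ▸ heightStackable-5-10

corners≤15 : InRange CornerStackable 0 15
corners≤15 = cornerStackable-lift corners≤6 (heightStackable-lift heights₅)

gathers⇒zeroStackable : ∀ {d n} (A : Vertex d → Bool) → Gathers (λ x → A x ≡ true) 𝟎 n → ZeroStackable A
gathers⇒zeroStackable {d} A gather = final , moves , on-zero
  where
  one-cup : ∀ x → A x ≡ true → initConfig A x ≡ 1
  one-cup x Ax rewrite Ax = refl
  origin : 1 ≤ initConfig A 𝟎
  origin with A 𝟎 | 𝟎 {d} ≟V 𝟎
  ... | true  | _      = s≤s z≤n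
  ... | false | yes _  = s≤s z≤n
  ... | false | no 𝟎≢𝟎 = contradiction refl 𝟎≢𝟎
  open Gathered (gather (initConfig A) one-cup origin)
  on-zero : AllOnZero final
  on-zero w w≢𝟎 with A w in Aw
  ... | true = emptied w Aw
  ... | false = trans (untouched w (λ Aw≡true → contradiction (trans (sym Aw) Aw≡true) λ ()) w≢𝟎) no-cup
    where
    no-cup : initConfig A w ≡ 0
    no-cup with w ≟V 𝟎
    ... | yes w≡𝟎 = contradiction w≡𝟎 w≢𝟎
    ... | no _ rewrite Aw = refl

++-isometric : ∀ {m k} (S : Vec Bool m) → Isometric (λ (y : Vertex k) → S ++ᵛ y)
++-isometric [] y y' = refl
++-isometric (b ∷ S) y y' = trans (dist-∷-same b (S ++ᵛ y) (S ++ᵛ y')) (++-isometric S y y')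

dist-++-𝟎 : ∀ {m k} (S : Vec Bool m) (y : Vertex k) → dist (S ++ᵛ y) 𝟎 ≡ popcount S + dist y 𝟎
dist-++-𝟎 [] y = refl
dist-++-𝟎 (true ∷ S) y = cong suc (dist-++-𝟎 S y)
dist-++-𝟎 (false ∷ S) y = dist-++-𝟎 S y

kCube≐Image : ∀ m k (S : Vec Bool m) → Image (S ++ᵛ_) U ≐ (λ x → kCube m k S x ≡ true)
kCube≐Image m k S = to , from
  where
  to : ∀ {x} → Image (S ++ᵛ_) U x → kCube m k S x ≡ true
  to (y , _ , refl) with take m (S ++ᵛ y) ≟V S
  ... | yes _ = refl
  ... | no take≢S = contradiction (++-injectiveˡ _ S (take++drop≡id m (S ++ᵛ y))) take≢S
  from : ∀ {x} → kCube m k S x ≡ true → Image (S ++ᵛ_) U x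
  from {x} inCube with take m x ≟V S
  ... | yes refl = drop m x , tt , take++drop≡id m x
  ... | no _ = contradiction inCube λ ()

lemma27 : (k l m : ℕ) → k ≤ 15 → (2 ^ k) ∸ k ≤ l → l ≤ 2 ^ k → l ≤ m →
    (S : Vec Bool m) → popcount S ≡ l → ZeroStackable (kCube m k S)
lemma27 k l m k≤15 lo hi _ S weight =
  gathers⇒zeroStackable (kCube m k S)
    (gathers-cong (kCube≐Image m k S)
      (heightStackable-window (at corners≤15 k z≤n k≤15) l lo hi (S ++ᵛ_) (++-isometric S) 𝟎
        (λ y → trans (dist-++-𝟎 S y) (cong (_+ dist y 𝟎) weight))))
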